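{- The Abelian complexity $\rho$ of the Tribonacci word satisfies $\rho(n)=7$ for infinitely many positive integers $n$.
   Context: Let $\tau$ be the morphism on $\{0,1,2\}^*$ given by $0\mapsto 01$, $1\mapsto 02$, $2\mapsto 0$, and let $\mathbf{t}=\lim_{n\to\infty}\tau^n(0)$ be its fixed point (the Tribonacci word). $\rho(n)$ is the number of distinct Parikh vectors $(|u|_0,|u|_1,|u|_2)$ of factors $u$ of $\mathbf{t}$ of length $n$, where $|u|_a$ is the number of occurrences of the letter $a$ in $u$. -}

module Defs where

open import Data.Nat using (ℕ; zero; suc; _+_; _<_)
open import Data.Fin using (Fin; zero; suc)
open import Data.List using (List; []; _∷_; _++_; concatMap; length; drop; take; head)
open import Data.List.Relation.Unary.Unique.Propositional using (Unique)
open import Data.List.Membership.Propositional using (_∈_)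
open import Data.Maybe using (Maybe; just; nothing; fromMaybe)
open import Data.Product using (_×_; _,_; ∃-syntax)
open import Relation.Binary.PropositionalEquality using (_≡_)

Letter : Set
Letter = Fin 3

τ : Letter → List Letter
τ zero = zero ∷ suc zero ∷ []
τ (suc zero) = zero ∷ suc (suc zero) ∷ []
τ (suc (suc zero)) = zero ∷ []

τ* : List Letter → List Letter
τ* = concatMap τ

τ^[_]0 : ℕ → List Letter
τ^[ zero ]0 = zero ∷ []
τ^[ suc k ]0 = τ* τ^[ k ]0

-- the i-th letter (0-indexed) of a list, defaulting to 0 if out of range
nth : List Letter → ℕ → Letter
nth w i = fromMaybe zero (head (drop i w))

-- The Tribonacci word t = lim τ^k(0): since τ^k(0) is a prefix of
-- τ^(k+1)(0) and |τ^k(0)| ≥ k+1, the i-th letter of t is the i-th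
-- letter of τ^(i)(0) (no default is ever used).
t : ℕ → Letter
t i = nth τ^[ i ]0 i

factor : ℕ → ℕ → List Letter
factor i zero = []
factor i (suc n) = t i ∷ factor (suc i) n

Parikh : Set
Parikh = ℕ × ℕ × ℕ

parikh : List Letter → Parikh
parikh [] = 0 , 0 , 0
parikh (zero ∷ u) with parikh u
... | a , b , c = suc a , b , c
parikh (suc zero ∷ u) with parikh u
... | a , b , c = a , suc b , c
parikh (suc (suc zero) ∷ u) with parikh u
... | a , b , c = a , b , suc c

IsParikhOfFactor : ℕ → Parikh → Set
IsParikhOfFactor n v = ∃[ i ] parikh (factor i n) ≡ v

-- ρ(n) = k : the set of Parikh vectors of length-n factors of t has
-- exactly k elements, witnessed by a duplicate-free list of length k
-- enumerating exactly that set.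
ρ≡ : ℕ → ℕ → Set
ρ≡ n k = ∃[ vs ] (Unique vs × length vs ≡ k
                  × (∀ v → v ∈ vs → IsParikhOfFactor n v)
                  × (∀ i → parikh (factor i n) ∈ vs))

module Submission where

-- Since t = τ(t), a factor of t of length n ≥ 2 sits inside the τ-image of a shorter factor,
-- starting at offset 0 or 1 of the image of its first letter and ending at offset 0 or 1 of
-- the image of the letter after it.  Hence the pairs (first letter, Parikh vector) of the factors
-- of the lengths in a window are determined by those of a window of shorter lengths, the
-- vectors being transformed by the incidence matrix of τ.  Recorded relative to a base vector,
-- such tables are carried by these desubstitution steps, each checked by computation, from the
-- lengths 1 and 2 to a table of nine rows that one step maps to itself, over ever longer
-- lengths.  Its fifth row has seven distinct vectors, so ρ(n) = 7 for arbitrarily large n.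

open import Defs
open import Data.Nat using (ℕ; zero; suc; _+_; _∸_; _≤_; _<_; z≤n; s≤s; s≤s⁻¹; _≟_; _≤?_; _<?_)
open import Data.Nat.Properties
open import Data.Nat.Tactic.RingSolver using (solve-∀)
open import Data.Fin using (zero; suc)
import Data.Fin.Properties as Fin
open import Data.List using (List; []; _∷_; _++_; length; take; map; filter; concat; concatMap; applyUpTo; replicate; deduplicate)
open import Data.List.Properties using (length-++; concatMap-++; length-map; ++-identityʳ)
open import Data.List.Membership.Propositional using (_∈_; find; lose)
open import Data.List.Membership.Propositional.Properties
  using (∈-++⁺ˡ; ∈-++⁺ʳ; ∈-++⁻; ∈-map⁺; ∈-map⁻; ∈-concatMap⁺; ∈-concatMap⁻; ∈-deduplicate⁺;
          ∈-deduplicate⁻; ∈-map∘filter⁺; ∈-map∘filter⁻)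
open import Data.List.Relation.Unary.Any using (here; there)
open import Data.List.Relation.Unary.All as All using (All)
open import Data.List.Relation.Binary.Pointwise using (Pointwise; []; _∷_)
import Data.List.Relation.Binary.Pointwise.Properties as Pointwise
open import Data.List.Relation.Unary.Unique.Propositional.Properties using (map⁺)
open import Data.Product using (∃-syntax; _×_; _,_; proj₁; proj₂)
open import Data.Product.Properties using (≡-dec)
open import Data.Sum using (_⊎_; inj₁; inj₂)
open import Data.Empty using (⊥; ⊥-elim)
open import Data.Unit using (⊤; tt)
open import Function using (_∘_)
open import Relation.Binary.PropositionalEquality
open import Relation.Nullary using (Dec; yes; no)
open import Relation.Nullary.Decidable using (toWitness; map′; _×-dec_; _⊎-dec_; _→-dec_)

-- Parikh vectors

infixl 6 _⊕_

_⊕_ : Parikh → Parikh → Parikh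
(a , b , c) ⊕ (x , y , z) = a + x , b + y , c + z

𝟘 e₀ : Parikh
𝟘 = 0 , 0 , 0
e₀ = 1 , 0 , 0

unit : Letter → Parikh
unit zero = e₀
unit (suc zero) = 0 , 1 , 0
unit (suc (suc zero)) = 0 , 0 , 1

Mτ : Parikh → Parikh
Mτ (a , b , c) = a + b + c , a , b

∣_∣ : Parikh → ℕ
∣ a , b , c ∣ = a + b + c

infix 4 _≟ᴾ_

_≟ᴾ_ : (u v : Parikh) → Dec (u ≡ v)
_≟ᴾ_ = ≡-dec _≟_ (≡-dec _≟_ _≟_)

open import Data.List.Relation.Unary.Unique.DecPropositional.Properties _≟ᴾ_ using (deduplicate-!)

parikh-≡ : ∀ {a b c x y z : ℕ} → a ≡ x → b ≡ y → c ≡ z → (a , b , c) ≡ (x , y , z)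
parikh-≡ p q r = cong₂ _,_ p (cong₂ _,_ q r)

⊕-assoc : ∀ u v w → u ⊕ v ⊕ w ≡ u ⊕ (v ⊕ w)
⊕-assoc (a , b , c) (x , y , z) (p , q , r) = parikh-≡ (+-assoc a x p) (+-assoc b y q) (+-assoc c z r)

⊕-comm : ∀ u v → u ⊕ v ≡ v ⊕ u
⊕-comm (a , b , c) (x , y , z) = parikh-≡ (+-comm a x) (+-comm b y) (+-comm c z)

⊕-identityʳ : ∀ u → u ⊕ 𝟘 ≡ u
⊕-identityʳ (a , b , c) = parikh-≡ (+-identityʳ a) (+-identityʳ b) (+-identityʳ c)

⊕-cancelʳ : ∀ u v w → u ⊕ w ≡ v ⊕ w → u ≡ v
⊕-cancelʳ (a , b , c) (x , y , z) (p , q , r) eq =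
  parikh-≡ (+-cancelʳ-≡ p a x (cong proj₁ eq))
           (+-cancelʳ-≡ q b y (cong (proj₁ ∘ proj₂) eq))
           (+-cancelʳ-≡ r c z (cong (proj₂ ∘ proj₂) eq))

⊕-cancelˡ : ∀ w u v → w ⊕ u ≡ w ⊕ v → u ≡ v
⊕-cancelˡ w u v eq = ⊕-cancelʳ u v w (trans (⊕-comm u w) (trans eq (⊕-comm w v)))

Mτ-⊕ : ∀ u v → Mτ (u ⊕ v) ≡ Mτ u ⊕ Mτ v
Mτ-⊕ (a , b , c) (x , y , z) = parikh-≡ (rearrange a b c x y z) refl refl
  where
  rearrange : ∀ a b c x y z → a + x + (b + y) + (c + z) ≡ a + b + c + (x + y + z)
  rearrange = solve-∀

∣⊕∣ : ∀ u v → ∣ u ⊕ v ∣ ≡ ∣ u ∣ + ∣ v ∣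
∣⊕∣ (a , b , c) (x , y , z) = rearrange a b c x y z
  where
  rearrange : ∀ a b c x y z → a + x + (b + y) + (c + z) ≡ a + b + c + (x + y + z)
  rearrange = solve-∀

∣Mτ-⊕∣ : ∀ u v → ∣ Mτ (u ⊕ v) ∣ ≡ ∣ Mτ u ∣ + ∣ Mτ v ∣
∣Mτ-⊕∣ u v = trans (cong ∣_∣ (Mτ-⊕ u v)) (∣⊕∣ (Mτ u) (Mτ v))

∣∣≤∣Mτ∣ : ∀ u → ∣ u ∣ ≤ ∣ Mτ u ∣
∣∣≤∣Mτ∣ (a , b , c) = ≤-trans (m≤m+n (a + b + c) a) (m≤m+n (a + b + c + a) b)

parikh-∷ : ∀ x u → parikh (x ∷ u) ≡ unit x ⊕ parikh u
parikh-∷ zero u with parikh u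
... | a , b , c = refl
parikh-∷ (suc zero) u with parikh u
... | a , b , c = refl
parikh-∷ (suc (suc zero)) u with parikh u
... | a , b , c = refl

parikh-++ : ∀ u v → parikh (u ++ v) ≡ parikh u ⊕ parikh v
parikh-++ [] v = refl
parikh-++ (x ∷ u) v = begin
  parikh (x ∷ u ++ v)              ≡⟨ parikh-∷ x (u ++ v) ⟩
  unit x ⊕ parikh (u ++ v)         ≡⟨ cong (unit x ⊕_) (parikh-++ u v) ⟩
  unit x ⊕ (parikh u ⊕ parikh v)   ≡⟨ ⊕-assoc (unit x) _ _ ⟨
  unit x ⊕ parikh u ⊕ parikh v     ≡⟨ cong (_⊕ parikh v) (parikh-∷ x u) ⟨
  parikh (x ∷ u) ⊕ parikh v        ∎
  where open ≡-Reasoning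

∣parikh∣ : ∀ u → ∣ parikh u ∣ ≡ length u
∣parikh∣ [] = refl
∣parikh∣ (x ∷ u) = begin
  ∣ parikh (x ∷ u) ∣           ≡⟨ cong ∣_∣ (parikh-∷ x u) ⟩
  ∣ unit x ⊕ parikh u ∣        ≡⟨ ∣⊕∣ (unit x) (parikh u) ⟩
  ∣ unit x ∣ + ∣ parikh u ∣    ≡⟨ cong₂ _+_ (∣unit∣ x) (∣parikh∣ u) ⟩
  suc (length u)               ∎
  where
  open ≡-Reasoning
  ∣unit∣ : ∀ a → ∣ unit a ∣ ≡ 1
  ∣unit∣ zero = refl
  ∣unit∣ (suc zero) = refl
  ∣unit∣ (suc (suc zero)) = refl

parikh-τ : ∀ a → parikh (τ a) ≡ Mτ (unit a)
parikh-τ zero = refl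
parikh-τ (suc zero) = refl
parikh-τ (suc (suc zero)) = refl

-- The Tribonacci word as the fixed point of τ

∣τ∣ : Letter → ℕ
∣τ∣ a = length (τ a)

∣τ∣≡∣Mτ∣ : ∀ a → ∣τ∣ a ≡ ∣ Mτ (unit a) ∣
∣τ∣≡∣Mτ∣ zero = refl
∣τ∣≡∣Mτ∣ (suc zero) = refl
∣τ∣≡∣Mτ∣ (suc (suc zero)) = refl

1≤∣τ∣ : ∀ a → 1 ≤ ∣τ∣ a
1≤∣τ∣ zero = s≤s z≤n
1≤∣τ∣ (suc zero) = s≤s z≤n
1≤∣τ∣ (suc (suc zero)) = s≤s z≤n

-- The letters whose image under τ has length 2, and the second letter of that image.
data NotTwo : Letter → Set where
  zero-NotTwo : NotTwo zero
  one-NotTwo : NotTwo (suc zero)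

next : Letter → Letter
next zero = suc zero
next (suc zero) = suc (suc zero)
next (suc (suc zero)) = zero

∣τ∣-NotTwo : ∀ {a} → NotTwo a → ∣τ∣ a ≡ 2
∣τ∣-NotTwo zero-NotTwo = refl
∣τ∣-NotTwo one-NotTwo = refl

NotTwo-or-two : ∀ a → NotTwo a ⊎ a ≡ suc (suc zero)
NotTwo-or-two zero = inj₁ zero-NotTwo
NotTwo-or-two (suc zero) = inj₁ one-NotTwo
NotTwo-or-two (suc (suc zero)) = inj₂ refl

length-τ* : ∀ u → length u ≤ length (τ* u)
length-τ* [] = z≤n
length-τ* (x ∷ u) = begin
  suc (length u)              ≤⟨ +-mono-≤ (1≤∣τ∣ x) (length-τ* u) ⟩
  ∣τ∣ x + length (τ* u)       ≡⟨ length-++ (τ x) ⟨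
  length (τ* (x ∷ u))         ∎
  where open ≤-Reasoning

τ^-prefix : ∀ k → ∃[ z ] τ^[ suc k ]0 ≡ τ^[ k ]0 ++ z × 1 ≤ length z
τ^-prefix zero = suc zero ∷ [] , refl , s≤s z≤n
τ^-prefix (suc k) with τ^-prefix k
... | z , eq , 1≤z = τ* z , trans (cong τ* eq) (concatMap-++ τ τ^[ k ]0 z) , ≤-trans 1≤z (length-τ* z)

length-τ^ : ∀ k → k < length τ^[ k ]0
length-τ^ zero = s≤s z≤n
length-τ^ (suc k) with τ^-prefix k
... | z , eq , 1≤z = begin-strict
  suc k                               ≡⟨ +-comm 1 k ⟩
  k + 1                               <⟨ +-mono-<-≤ (length-τ^ k) 1≤z ⟩
  length τ^[ k ]0 + length z          ≡⟨ length-++ τ^[ k ]0 ⟨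
  length (τ^[ k ]0 ++ z)              ≡⟨ cong length eq ⟨
  length τ^[ suc k ]0                 ∎
  where open ≤-Reasoning

nth-++ˡ : ∀ u v i → i < length u → nth (u ++ v) i ≡ nth u i
nth-++ˡ (x ∷ u) v zero _ = refl
nth-++ˡ (x ∷ u) v (suc i) (s≤s i<u) = nth-++ˡ u v i i<u

nth-++ʳ : ∀ u v i → nth (u ++ v) (length u + i) ≡ nth v i
nth-++ʳ [] v i = refl
nth-++ʳ (x ∷ u) v i = nth-++ʳ u v i

nth-τ^ : ∀ i k → i ≤ k → nth τ^[ k ]0 i ≡ t i
nth-τ^ i k i≤k = subst (λ k → nth τ^[ k ]0 i ≡ t i) (m∸n+n≡m i≤k) (go (k ∸ i))
  where
  go : ∀ p → nth τ^[ p + i ]0 i ≡ t i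
  go zero = refl
  go (suc p) with τ^-prefix (p + i)
  ... | z , eq , _ = begin
    nth τ^[ suc p + i ]0 i           ≡⟨ cong (λ w → nth w i) eq ⟩
    nth (τ^[ p + i ]0 ++ z) i        ≡⟨ nth-++ˡ τ^[ p + i ]0 z i (≤-<-trans (m≤n+m i p) (length-τ^ (p + i))) ⟩
    nth τ^[ p + i ]0 i               ≡⟨ go p ⟩
    t i                              ∎
    where open ≡-Reasoning

-- The position at which the image of the letter t i starts in t = τ(t).
σ : ℕ → ℕ
σ zero = 0
σ (suc i) = σ i + ∣τ∣ (t i)

σ-mono : ∀ {i k} → i ≤ k → σ i ≤ σ k
σ-mono {i} i≤k = subst (λ k → σ i ≤ σ k) (m∸n+n≡m i≤k) (go (_ ∸ i))
  where
  go : ∀ p → σ i ≤ σ (p + i)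
  go zero = ≤-refl
  go (suc p) = ≤-trans (go p) (m≤m+n (σ (p + i)) _)

nth-τ* : ∀ u i k → i < length u → k < ∣τ∣ (nth u i) → nth (τ* u) (length (τ* (take i u)) + k) ≡ nth (τ (nth u i)) k
nth-τ* (x ∷ u) zero k _ k<τx = nth-++ˡ (τ x) (τ* u) k k<τx
nth-τ* (x ∷ u) (suc i) k (s≤s i<u) k<τ = begin
  nth (τ x ++ τ* u) (length (τ x ++ τ* (take i u)) + k)     ≡⟨ cong (λ n → nth (τ x ++ τ* u) (n + k)) (length-++ (τ x)) ⟩
  nth (τ x ++ τ* u) (∣τ∣ x + length (τ* (take i u)) + k)   ≡⟨ cong (nth (τ x ++ τ* u)) (+-assoc (∣τ∣ x) _ k) ⟩
  nth (τ x ++ τ* u) (∣τ∣ x + (length (τ* (take i u)) + k)) ≡⟨ nth-++ʳ (τ x) (τ* u) _ ⟩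
  nth (τ* u) (length (τ* (take i u)) + k)                   ≡⟨ nth-τ* u i k i<u k<τ ⟩
  nth (τ (nth u i)) k                                       ∎
  where open ≡-Reasoning

take-suc : ∀ (u : List Letter) i → i < length u → take (suc i) u ≡ take i u ++ nth u i ∷ []
take-suc (x ∷ u) zero _ = refl
take-suc (x ∷ u) (suc i) (s≤s i<u) = cong (x ∷_) (take-suc u i i<u)

length-τ*-take : ∀ k i → i ≤ k → length (τ* (take i τ^[ k ]0)) ≡ σ i
length-τ*-take k zero _ = refl
length-τ*-take k (suc i) i<k = begin
  length (τ* (take (suc i) W))                      ≡⟨ cong (length ∘ τ*) (take-suc W i (<-trans i<k (length-τ^ k))) ⟩
  length (τ* (take i W ++ nth W i ∷ []))           ≡⟨ cong length (concatMap-++ τ (take i W) _) ⟩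
  length (τ* (take i W) ++ τ (nth W i) ++ [])      ≡⟨ length-++ (τ* (take i W)) ⟩
  length (τ* (take i W)) + length (τ (nth W i) ++ [])
    ≡⟨ cong₂ _+_ (length-τ*-take k i (<⇒≤ i<k)) (cong length (++-identityʳ (τ (nth W i)))) ⟩
  σ i + ∣τ∣ (nth W i)                              ≡⟨ cong (λ a → σ i + ∣τ∣ a) (nth-τ^ i k (<⇒≤ i<k)) ⟩
  σ i + ∣τ∣ (t i)                                  ∎
  where
  open ≡-Reasoning
  W = τ^[ k ]0

t-σ+ : ∀ i k → k < ∣τ∣ (t i) → t (σ i + k) ≡ nth (τ (t i)) k
t-σ+ i k k<τ = begin
  t (σ i + k)                                ≡⟨ nth-τ^ (σ i + k) (suc K) (m≤n⇒m≤1+n (m≤m+n _ i)) ⟨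
  nth (τ* W) (σ i + k)                       ≡⟨ cong (λ n → nth (τ* W) (n + k)) (length-τ*-take K i (m≤n+m i _)) ⟨
  nth (τ* W) (length (τ* (take i W)) + k)    ≡⟨ nth-τ* W i k (≤-<-trans (m≤n+m i _) (length-τ^ K)) (subst (λ a → k < ∣τ∣ a) (sym ti) k<τ) ⟩
  nth (τ (nth W i)) k                        ≡⟨ cong (λ a → nth (τ a) k) ti ⟩
  nth (τ (t i)) k                            ∎
  where
  open ≡-Reasoning
  K = σ i + k + i
  W = τ^[ K ]0
  ti = nth-τ^ i K (m≤n+m i _)

t-σ : ∀ i → t (σ i) ≡ zero
t-σ i = trans (cong t (sym (+-identityʳ (σ i)))) (trans (t-σ+ i 0 (1≤∣τ∣ (t i))) (τ-head (t i)))
  where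
  τ-head : ∀ a → nth (τ a) 0 ≡ zero
  τ-head zero = refl
  τ-head (suc zero) = refl
  τ-head (suc (suc zero)) = refl

t-σ+1 : ∀ i → NotTwo (t i) → t (suc (σ i)) ≡ next (t i)
t-σ+1 i nt = begin
  t (suc (σ i))          ≡⟨ cong t (+-comm 1 (σ i)) ⟩
  t (σ i + 1)            ≡⟨ t-σ+ i 1 (≤-reflexive (sym (∣τ∣-NotTwo nt))) ⟩
  nth (τ (t i)) 1        ≡⟨ τ-second nt ⟩
  next (t i)             ∎
  where
  open ≡-Reasoning
  τ-second : ∀ {a} → NotTwo a → nth (τ a) 1 ≡ next a
  τ-second zero-NotTwo = refl
  τ-second one-NotTwo = refl

-- Position j of t lies in the block τ(t i), which starts at σ i.
data InBlock (j i : ℕ) : Set where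
  at-σ : j ≡ σ i → InBlock j i
  at-σ+1 : j ≡ suc (σ i) → NotTwo (t i) → InBlock j i

block : ∀ j → ∃[ i ] InBlock j i
block zero = 0 , at-σ refl
block (suc j) with block j
... | i , at-σ+1 refl nt = suc i , at-σ (trans (+-comm 2 (σ i)) (cong (σ i +_) (sym (∣τ∣-NotTwo nt))))
... | i , at-σ refl with NotTwo-or-two (t i)
...   | inj₁ nt = i , at-σ+1 refl nt
...   | inj₂ ti≡2 = suc i , at-σ (trans (+-comm 1 (σ i)) (cong (λ a → σ i + ∣τ∣ a) (sym ti≡2)))

σ≤-InBlock : ∀ {j i} → InBlock j i → σ i ≤ j
σ≤-InBlock (at-σ refl) = ≤-refl
σ≤-InBlock (at-σ+1 refl _) = n≤1+n _

≤σ+1-InBlock : ∀ {j i} → InBlock j i → j ≤ suc (σ i)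
≤σ+1-InBlock (at-σ refl) = n≤1+n _
≤σ+1-InBlock (at-σ+1 refl _) = ≤-refl

ψ : ℕ → ℕ → Parikh
ψ i n = parikh (factor i n)

factor-+ : ∀ i n m → factor i (n + m) ≡ factor i n ++ factor (i + n) m
factor-+ i zero m = cong (λ j → factor j m) (sym (+-identityʳ i))
factor-+ i (suc n) m = cong (t i ∷_) (trans (factor-+ (suc i) n m) (cong (λ j → factor (suc i) n ++ factor j m) (sym (+-suc i n))))

ψ-+ : ∀ i n m → ψ i (n + m) ≡ ψ i n ⊕ ψ (i + n) m
ψ-+ i n m = trans (cong parikh (factor-+ i n m)) (parikh-++ (factor i n) _)

ψ-suc : ∀ i n → ψ i (suc n) ≡ unit (t i) ⊕ ψ (suc i) n
ψ-suc i n = parikh-∷ (t i) (factor (suc i) n)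

ψ-1 : ∀ i → ψ i 1 ≡ unit (t i)
ψ-1 i = trans (ψ-suc i 0) (⊕-identityʳ (unit (t i)))

∣ψ∣ : ∀ i n → ∣ ψ i n ∣ ≡ n
∣ψ∣ i n = trans (∣parikh∣ (factor i n)) (length-factor i n)
  where
  length-factor : ∀ i n → length (factor i n) ≡ n
  length-factor i zero = refl
  length-factor i (suc n) = cong suc (length-factor (suc i) n)

parikh-τ* : ∀ u → parikh (τ* u) ≡ Mτ (parikh u)
parikh-τ* [] = refl
parikh-τ* (x ∷ u) = begin
  parikh (τ x ++ τ* u)               ≡⟨ parikh-++ (τ x) (τ* u) ⟩
  parikh (τ x) ⊕ parikh (τ* u)       ≡⟨ cong₂ _⊕_ (parikh-τ x) (parikh-τ* u) ⟩
  Mτ (unit x) ⊕ Mτ (parikh u)        ≡⟨ Mτ-⊕ (unit x) (parikh u) ⟨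
  Mτ (unit x ⊕ parikh u)             ≡⟨ cong Mτ (parikh-∷ x u) ⟨
  Mτ (parikh (x ∷ u))                ∎
  where open ≡-Reasoning

length-τ*≡∣Mτ∣ : ∀ u → length (τ* u) ≡ ∣ Mτ (parikh u) ∣
length-τ*≡∣Mτ∣ u = trans (sym (∣parikh∣ (τ* u))) (cong ∣_∣ (parikh-τ* u))

factor-≡ : ∀ j u → (∀ k → k < length u → t (j + k) ≡ nth u k) → factor j (length u) ≡ u
factor-≡ j [] _ = refl
factor-≡ j (x ∷ u) agree =
  cong₂ _∷_ (trans (cong t (sym (+-identityʳ j))) (agree 0 (s≤s z≤n)))
            (factor-≡ (suc j) u (λ k k<u → trans (cong t (sym (+-suc j k))) (agree (suc k) (s≤s k<u))))

σ-+ : ∀ i m → σ (i + m) ≡ σ i + length (τ* (factor i m))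
σ-+ i zero = trans (cong σ (+-identityʳ i)) (sym (+-identityʳ (σ i)))
σ-+ i (suc m) = begin
  σ (i + suc m)                                         ≡⟨ cong σ (+-suc i m) ⟩
  σ (suc i + m)                                         ≡⟨ σ-+ (suc i) m ⟩
  σ i + ∣τ∣ (t i) + length (τ* (factor (suc i) m))      ≡⟨ +-assoc (σ i) _ _ ⟩
  σ i + (∣τ∣ (t i) + length (τ* (factor (suc i) m)))    ≡⟨ cong (σ i +_) (length-++ (τ (t i))) ⟨
  σ i + length (τ* (factor i (suc m)))                  ∎
  where open ≡-Reasoning

factor-σ : ∀ i m → factor (σ i) (length (τ* (factor i m))) ≡ τ* (factor i m)
factor-σ i zero = refl
factor-σ i (suc m) = begin
  factor (σ i) (length (τ (t i) ++ τ* (factor (suc i) m)))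
    ≡⟨ cong (factor (σ i)) (length-++ (τ (t i))) ⟩
  factor (σ i) (∣τ∣ (t i) + length (τ* (factor (suc i) m)))
    ≡⟨ factor-+ (σ i) (∣τ∣ (t i)) _ ⟩
  factor (σ i) (∣τ∣ (t i)) ++ factor (σ (suc i)) (length (τ* (factor (suc i) m)))
    ≡⟨ cong₂ _++_ (factor-≡ (σ i) (τ (t i)) (t-σ+ i)) (factor-σ (suc i) m) ⟩
  τ (t i) ++ τ* (factor (suc i) m)
    ∎
  where open ≡-Reasoning

σ-+-ψ : ∀ i m → σ (i + m) ≡ σ i + ∣ Mτ (ψ i m) ∣
σ-+-ψ i m = trans (σ-+ i m) (cong (σ i +_) (length-τ*≡∣Mτ∣ (factor i m)))

ψ-σ : ∀ i m → ψ (σ i) ∣ Mτ (ψ i m) ∣ ≡ Mτ (ψ i m)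
ψ-σ i m = begin
  ψ (σ i) ∣ Mτ (ψ i m) ∣                     ≡⟨ cong (ψ (σ i)) (length-τ*≡∣Mτ∣ (factor i m)) ⟨
  parikh (factor (σ i) (length (τ* u)))      ≡⟨ cong parikh (factor-σ i m) ⟩
  parikh (τ* u)                              ≡⟨ parikh-τ* u ⟩
  Mτ (ψ i m)                                 ∎
  where
  open ≡-Reasoning
  u = factor i m

ψ-σ-suc : ∀ i m → ψ (σ i) (suc ∣ Mτ (ψ i m) ∣) ≡ Mτ (ψ i m) ⊕ e₀
ψ-σ-suc i m = begin
  ψ (σ i) (suc L)                 ≡⟨ cong (ψ (σ i)) (+-comm 1 L) ⟩
  ψ (σ i) (L + 1)                 ≡⟨ ψ-+ (σ i) L 1 ⟩
  ψ (σ i) L ⊕ ψ (σ i + L) 1       ≡⟨ cong₂ _⊕_ (ψ-σ i m) (cong (λ j → ψ j 1) (sym (σ-+-ψ i m))) ⟩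
  Mτ (ψ i m) ⊕ ψ (σ (i + m)) 1    ≡⟨ cong (Mτ (ψ i m) ⊕_) (trans (ψ-1 (σ (i + m))) (cong unit (t-σ (i + m)))) ⟩
  Mτ (ψ i m) ⊕ e₀                 ∎
  where
  open ≡-Reasoning
  L = ∣ Mτ (ψ i m) ∣

ψ-σ-∷ : ∀ i n → ψ (σ i) (suc n) ≡ e₀ ⊕ ψ (suc (σ i)) n
ψ-σ-∷ i n = trans (ψ-suc (σ i) n) (cong (λ a → unit a ⊕ ψ (suc (σ i)) n) (t-σ i))

-- Desubstitution

Entry : Set
Entry = Letter × Parikh

_≟ᴱ_ : (e e′ : Entry) → Dec (e ≡ e′)
_≟ᴱ_ = ≡-dec Fin._≟_ _≟ᴾ_

open import Data.List.Membership.DecPropositional _≟ᴱ_ using (_∈?_)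

Occurs : ℕ → Entry → Set
Occurs n (a , v) = ∃[ j ] t j ≡ a × ψ j n ≡ v

-- Yields (a , v) n e: the τ-image of a factor with first letter a and Parikh vector v
-- contains a length n factor, described by e, that starts at offset 0 or 1 of the image and
-- ends at offset 0 or 1 of the image of the next letter.
data Yields : Entry → ℕ → Entry → Set where
  from-σ-to-σ : ∀ {a v} → Yields (a , v) ∣ Mτ v ∣ (zero , Mτ v)
  from-σ-to-σ+1 : ∀ {a v} → Yields (a , v) (suc ∣ Mτ v ∣) (zero , Mτ v ⊕ e₀)
  from-σ+1-to-σ : ∀ {a v n w} → NotTwo a → suc n ≡ ∣ Mτ v ∣ → e₀ ⊕ w ≡ Mτ v → Yields (a , v) n (next a , w)
  from-σ+1-to-σ+1 : ∀ {a v} → NotTwo a → Yields (a , v) ∣ Mτ v ∣ (next a , Mτ v)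

from-σ-to-σ′ : ∀ {a v n b w} → n ≡ ∣ Mτ v ∣ → b ≡ zero → w ≡ Mτ v → Yields (a , v) n (b , w)
from-σ-to-σ′ refl refl refl = from-σ-to-σ

from-σ-to-σ+1′ : ∀ {a v n b w} → n ≡ suc ∣ Mτ v ∣ → b ≡ zero → w ≡ Mτ v ⊕ e₀ → Yields (a , v) n (b , w)
from-σ-to-σ+1′ refl refl refl = from-σ-to-σ+1

from-σ+1-to-σ′ : ∀ {a v n b w} → NotTwo a → suc n ≡ ∣ Mτ v ∣ → b ≡ next a → e₀ ⊕ w ≡ Mτ v → Yields (a , v) n (b , w)
from-σ+1-to-σ′ nt n+1 refl e₀w = from-σ+1-to-σ nt n+1 e₀w

from-σ+1-to-σ+1′ : ∀ {a v n b w} → NotTwo a → n ≡ ∣ Mτ v ∣ → b ≡ next a → w ≡ Mτ v → Yields (a , v) n (b , w)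
from-σ+1-to-σ+1′ nt refl refl refl = from-σ+1-to-σ+1 nt

yields-occurs : ∀ i m {n e} → Yields (t i , ψ i m) n e → Occurs n e
yields-occurs i m from-σ-to-σ = σ i , t-σ i , ψ-σ i m
yields-occurs i m from-σ-to-σ+1 = σ i , t-σ i , ψ-σ-suc i m
yields-occurs i m (from-σ+1-to-σ {n = n} {w = w} nt n+1 e₀w) = suc (σ i) , t-σ+1 i nt , ⊕-cancelˡ e₀ _ _ (begin
  e₀ ⊕ ψ (suc (σ i)) n       ≡⟨ ψ-σ-∷ i n ⟨
  ψ (σ i) (suc n)            ≡⟨ cong (ψ (σ i)) n+1 ⟩
  ψ (σ i) ∣ Mτ (ψ i m) ∣     ≡⟨ ψ-σ i m ⟩
  Mτ (ψ i m)                 ≡⟨ e₀w ⟨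
  e₀ ⊕ w                     ∎)
  where open ≡-Reasoning
yields-occurs i m (from-σ+1-to-σ+1 nt) = suc (σ i) , t-σ+1 i nt ,
  ⊕-cancelʳ _ _ e₀ (trans (⊕-comm _ e₀) (trans (sym (ψ-σ-∷ i _)) (ψ-σ-suc i m)))

block-order : ∀ {j n i k} → 2 ≤ n → InBlock j i → InBlock (j + n) k → i < k
block-order {j} {n} {i} {k} 2≤n bi bk with i <? k
... | yes i<k = i<k
... | no i≮k = ⊥-elim (<-irrefl refl (begin-strict
  j + n              ≤⟨ ≤σ+1-InBlock bk ⟩
  suc (σ k)          ≤⟨ s≤s (σ-mono (≮⇒≥ i≮k)) ⟩
  suc (σ i)          ≤⟨ s≤s (σ≤-InBlock bi) ⟩
  suc j              <⟨ ≤-reflexive (+-comm 2 j) ⟩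
  j + 2              ≤⟨ +-monoʳ-≤ j 2≤n ⟩
  j + n              ∎))
  where open ≤-Reasoning

has-ancestor : ∀ n j → 2 ≤ n → ∃[ i ] ∃[ m ] 1 ≤ m × Yields (t i , ψ i m) n (t j , ψ j n)
has-ancestor n j 2≤n with block j | block (j + n)
... | i , bi | k , bk = i , k ∸ i , m<n⇒0<n∸m i<k , yields bi bk
  where
  i<k = block-order 2≤n bi bk
  v = ψ i (k ∸ i)
  L = ∣ Mτ v ∣
  σk : σ k ≡ σ i + L
  σk = trans (cong σ (sym (m+[n∸m]≡n (<⇒≤ i<k)))) (σ-+-ψ i (k ∸ i))
  yields : InBlock j i → InBlock (j + n) k → Yields (t i , v) n (t j , ψ j n)
  yields (at-σ refl) (at-σ e) = from-σ-to-σ′ n≡L (t-σ i) (trans (cong (ψ (σ i)) n≡L) (ψ-σ i (k ∸ i)))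
    where n≡L = +-cancelˡ-≡ (σ i) n L (trans e σk)
  yields (at-σ refl) (at-σ+1 e _) = from-σ-to-σ+1′ n≡L+1 (t-σ i) (trans (cong (ψ (σ i)) n≡L+1) (ψ-σ-suc i (k ∸ i)))
    where n≡L+1 = +-cancelˡ-≡ (σ i) n (suc L) (trans e (trans (cong suc σk) (sym (+-suc (σ i) L))))
  yields (at-σ+1 refl nt) (at-σ e) = from-σ+1-to-σ′ nt n+1≡L (t-σ+1 i nt)
      (trans (sym (ψ-σ-∷ i n)) (trans (cong (ψ (σ i)) n+1≡L) (ψ-σ i (k ∸ i))))
    where n+1≡L = +-cancelˡ-≡ (σ i) (suc n) L (trans (+-suc (σ i) n) (trans e σk))
  yields (at-σ+1 refl nt) (at-σ+1 e _) = from-σ+1-to-σ+1′ nt n≡L (t-σ+1 i nt)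
      (⊕-cancelʳ _ _ e₀ (trans (⊕-comm _ e₀) (trans (sym (ψ-σ-∷ i n)) (trans (cong (ψ (σ i) ∘ suc) n≡L) (ψ-σ-suc i (k ∸ i))))))
    where n≡L = +-cancelˡ-≡ (σ i) n L (suc-injective (trans e (cong suc σk)))

yields-≤ : ∀ {a v n e} → Yields (a , v) n e → n ≤ suc ∣ Mτ v ∣
yields-≤ from-σ-to-σ = n≤1+n _
yields-≤ from-σ-to-σ+1 = ≤-refl
yields-≤ (from-σ+1-to-σ _ n+1 _) = ≤-trans (n≤1+n _) (≤-trans (≤-reflexive n+1) (n≤1+n _))
yields-≤ (from-σ+1-to-σ+1 _) = n≤1+n _

∣Mτψ∣-+ : ∀ i m r → ∣ Mτ (ψ i (m + r)) ∣ ≡ ∣ Mτ (ψ i m) ∣ + ∣ Mτ (ψ (i + m) r) ∣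
∣Mτψ∣-+ i m r = trans (cong (∣_∣ ∘ Mτ) (ψ-+ i m r)) (∣Mτ-⊕∣ (ψ i m) (ψ (i + m) r))

length≤∣Mτψ∣ : ∀ j r → r ≤ ∣ Mτ (ψ j r) ∣
length≤∣Mτψ∣ j r = subst (_≤ ∣ Mτ (ψ j r) ∣) (∣ψ∣ j r) (∣∣≤∣Mτ∣ (ψ j r))

short-ancestor-bound : ∀ i m A {n e} → Yields (t i , ψ i m) n e → m < A → n ≤ ∣ Mτ (ψ i A) ∣
short-ancestor-bound i m A {n} y m<A = begin
  n                                              ≤⟨ yields-≤ y ⟩
  suc ∣ Mτ (ψ i m) ∣                             ≡⟨ +-comm 1 _ ⟩
  ∣ Mτ (ψ i m) ∣ + 1                             ≤⟨ +-monoʳ-≤ _ (≤-trans (m<n⇒0<n∸m m<A) (length≤∣Mτψ∣ (i + m) (A ∸ m))) ⟩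
  ∣ Mτ (ψ i m) ∣ + ∣ Mτ (ψ (i + m) (A ∸ m)) ∣     ≡⟨ ∣Mτψ∣-+ i m (A ∸ m) ⟨
  ∣ Mτ (ψ i (m + (A ∸ m))) ∣                     ≡⟨ cong (λ l → ∣ Mτ (ψ i l) ∣) (m+[n∸m]≡n (<⇒≤ m<A)) ⟩
  ∣ Mτ (ψ i A) ∣                                 ∎
  where open ≤-Reasoning

∣Mτψ-suc∣≥ : ∀ i H r → ∣τ∣ (t i) + ∣ Mτ (ψ (suc i) H) ∣ ≤ ∣ Mτ (ψ i (suc (H + r))) ∣
∣Mτψ-suc∣≥ i H r = begin
  ∣τ∣ (t i) + ∣ Mτ (ψ (suc i) H) ∣                                  ≤⟨ +-monoʳ-≤ (∣τ∣ (t i)) (m≤m+n _ _) ⟩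
  ∣τ∣ (t i) + (∣ Mτ (ψ (suc i) H) ∣ + ∣ Mτ (ψ (suc i + H) r) ∣)     ≡⟨ cong₂ _+_ (∣τ∣≡∣Mτ∣ (t i)) (sym (∣Mτψ∣-+ (suc i) H r)) ⟩
  ∣ Mτ (unit (t i)) ∣ + ∣ Mτ (ψ (suc i) (H + r)) ∣                   ≡⟨ ∣Mτ-⊕∣ (unit (t i)) _ ⟨
  ∣ Mτ (unit (t i) ⊕ ψ (suc i) (H + r)) ∣                           ≡⟨ cong (∣_∣ ∘ Mτ) (ψ-suc i (H + r)) ⟨
  ∣ Mτ (ψ i (suc (H + r))) ∣                                        ∎
  where open ≤-Reasoning

long-ancestor-bound : ∀ i H r {n e} → Yields (t i , ψ i (suc (H + r))) n e → suc ∣ Mτ (ψ (suc i) H) ∣ ≤ n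
long-ancestor-bound i H r from-σ-to-σ = ≤-trans (+-monoˡ-≤ _ (1≤∣τ∣ (t i))) (∣Mτψ-suc∣≥ i H r)
long-ancestor-bound i H r from-σ-to-σ+1 = ≤-trans (+-monoˡ-≤ _ (1≤∣τ∣ (t i))) (≤-trans (∣Mτψ-suc∣≥ i H r) (n≤1+n _))
long-ancestor-bound i H r (from-σ+1-to-σ nt n+1 _) =
  s≤s⁻¹ (≤-trans (≤-reflexive (cong (_+ ∣ Mτ (ψ (suc i) H) ∣) (sym (∣τ∣-NotTwo nt)))) (≤-trans (∣Mτψ-suc∣≥ i H r) (≤-reflexive (sym n+1))))
long-ancestor-bound i H r (from-σ+1-to-σ+1 _) = ≤-trans (+-monoˡ-≤ _ (1≤∣τ∣ (t i))) (∣Mτψ-suc∣≥ i H r)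

σ+1-candidates : Letter → Parikh → List (ℕ × Entry)
σ+1-candidates zero u = (∣ u ∣ , suc zero , u) ∷ (suc ∣ u ∣ , suc zero , u ⊕ e₀) ∷ []
σ+1-candidates (suc zero) u = (∣ u ∣ , suc (suc zero) , u) ∷ (suc ∣ u ∣ , suc (suc zero) , u ⊕ e₀) ∷ []
σ+1-candidates (suc (suc zero)) u = []

-- Relative to a base vector C, the entry (a , C ⊕ o) yields the length n factors (b , v) with
-- (ℓ , b , w) ∈ candidates (a , o), suc n ≡ ∣ Mτ C ∣ + ℓ and v ⊕ e₀ ≡ Mτ C ⊕ w.  Lengths and
-- vectors carry one extra letter 0 so that the starts at σ + 1, which drop that letter,
-- need no subtraction.
candidates : Entry → List (ℕ × Entry)
candidates (a , o) =
  (suc ∣ Mτ o ∣ , zero , Mτ o ⊕ e₀) ∷ (suc (suc ∣ Mτ o ∣) , zero , Mτ o ⊕ (e₀ ⊕ e₀)) ∷ σ+1-candidates a (Mτ o)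

∈-σ+1-candidates-σ : ∀ {a} u → NotTwo a → (∣ u ∣ , next a , u) ∈ σ+1-candidates a u
∈-σ+1-candidates-σ u zero-NotTwo = here refl
∈-σ+1-candidates-σ u one-NotTwo = here refl

∈-σ+1-candidates-σ+1 : ∀ {a} u → NotTwo a → (suc ∣ u ∣ , next a , u ⊕ e₀) ∈ σ+1-candidates a u
∈-σ+1-candidates-σ+1 u zero-NotTwo = there (here refl)
∈-σ+1-candidates-σ+1 u one-NotTwo = there (here refl)

σ+1-candidates-∈ : ∀ a u {p} → p ∈ σ+1-candidates a u →
  NotTwo a × (p ≡ (∣ u ∣ , next a , u) ⊎ p ≡ (suc ∣ u ∣ , next a , u ⊕ e₀))
σ+1-candidates-∈ zero u (here refl) = zero-NotTwo , inj₁ refl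
σ+1-candidates-∈ zero u (there (here refl)) = zero-NotTwo , inj₂ refl
σ+1-candidates-∈ (suc zero) u (here refl) = one-NotTwo , inj₁ refl
σ+1-candidates-∈ (suc zero) u (there (here refl)) = one-NotTwo , inj₂ refl
σ+1-candidates-∈ (suc (suc zero)) u ()

∣Mτ-⊕∣-+ : ∀ C o k → k + ∣ Mτ (C ⊕ o) ∣ ≡ ∣ Mτ C ∣ + (k + ∣ Mτ o ∣)
∣Mτ-⊕∣-+ C o k = trans (cong (k +_) (∣Mτ-⊕∣ C o)) (exchange k ∣ Mτ C ∣ ∣ Mτ o ∣)
  where
  exchange : ∀ k x y → k + (x + y) ≡ x + (k + y)
  exchange = solve-∀

Mτ-⊕-⊕ : ∀ C o x → Mτ (C ⊕ o) ⊕ x ≡ Mτ C ⊕ (Mτ o ⊕ x)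
Mτ-⊕-⊕ C o x = trans (cong (_⊕ x) (Mτ-⊕ C o)) (⊕-assoc (Mτ C) (Mτ o) x)

candidates-complete : ∀ C a o {n b v} → Yields (a , C ⊕ o) n (b , v) →
  ∃[ ℓ ] ∃[ w ] (ℓ , b , w) ∈ candidates (a , o) × suc n ≡ ∣ Mτ C ∣ + ℓ × v ⊕ e₀ ≡ Mτ C ⊕ w
candidates-complete C a o from-σ-to-σ =
  _ , _ , here refl , ∣Mτ-⊕∣-+ C o 1 , Mτ-⊕-⊕ C o e₀
candidates-complete C a o from-σ-to-σ+1 =
  _ , _ , there (here refl) , ∣Mτ-⊕∣-+ C o 2 , trans (⊕-assoc _ e₀ e₀) (Mτ-⊕-⊕ C o (e₀ ⊕ e₀))
candidates-complete C a o (from-σ+1-to-σ nt n+1 e₀w) =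
  _ , _ , there (there (∈-σ+1-candidates-σ (Mτ o) nt)) , trans n+1 (∣Mτ-⊕∣-+ C o 0) ,
  trans (⊕-comm _ e₀) (trans e₀w (Mτ-⊕ C o))
candidates-complete C a o (from-σ+1-to-σ+1 nt) =
  _ , _ , there (there (∈-σ+1-candidates-σ+1 (Mτ o) nt)) , ∣Mτ-⊕∣-+ C o 1 , Mτ-⊕-⊕ C o e₀

candidates-sound : ∀ C a o {n ℓ b w v} → (ℓ , b , w) ∈ candidates (a , o) → suc n ≡ ∣ Mτ C ∣ + ℓ → v ⊕ e₀ ≡ Mτ C ⊕ w →
  Yields (a , C ⊕ o) n (b , v)
candidates-sound C a o (here refl) len vec =
  from-σ-to-σ′ (suc-injective (trans len (sym (∣Mτ-⊕∣-+ C o 1)))) refl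
               (⊕-cancelʳ _ _ e₀ (trans vec (sym (Mτ-⊕-⊕ C o e₀))))
candidates-sound C a o (there (here refl)) len vec =
  from-σ-to-σ+1′ (suc-injective (trans len (sym (∣Mτ-⊕∣-+ C o 2)))) refl
                 (⊕-cancelʳ _ _ e₀ (trans vec (trans (sym (Mτ-⊕-⊕ C o (e₀ ⊕ e₀))) (sym (⊕-assoc _ e₀ e₀)))))
candidates-sound C a o (there (there p∈)) len vec with σ+1-candidates-∈ a (Mτ o) p∈
... | nt , inj₁ refl = from-σ+1-to-σ′ nt (trans len (sym (∣Mτ-⊕∣-+ C o 0))) refl
                         (trans (⊕-comm e₀ _) (trans vec (sym (Mτ-⊕ C o))))
... | nt , inj₂ refl = from-σ+1-to-σ+1′ nt (suc-injective (trans len (sym (∣Mτ-⊕∣-+ C o 1)))) refl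
                         (⊕-cancelʳ _ _ e₀ (trans vec (sym (Mτ-⊕-⊕ C o e₀))))

-- Tables of factors

Row Table : Set
Row = List Entry
Table = List Row

RowTabulates : ℕ → Parikh → Row → Set
RowTabulates n C r = (∀ j → ∃[ o ] (t j , o) ∈ r × ψ j n ≡ C ⊕ o) × (∀ {a o} → (a , o) ∈ r → Occurs n (a , C ⊕ o))

Tabulates : ℕ → Parikh → Table → Set
Tabulates n C [] = ⊤
Tabulates n C (r ∷ T) = RowTabulates n C r × Tabulates (suc n) C T

row : Table → ℕ → Row
row [] _ = []
row (r ∷ T) zero = r
row (r ∷ T) (suc k) = row T k

tabulates-row : ∀ {n C} T → Tabulates n C T → ∀ k → k < length T → RowTabulates (n + k) C (row T k)
tabulates-row {n} {C} (r ∷ T) (R , _) zero _ = subst (λ m → RowTabulates m C r) (sym (+-identityʳ n)) R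
tabulates-row {n} {C} (r ∷ T) (_ , K) (suc k) (s≤s k<T) =
  subst (λ m → RowTabulates m C (row T k)) (sym (+-suc n k)) (tabulates-row T K k k<T)

tabulates-applyUpTo : ∀ {n C} f W → (∀ k → k < W → RowTabulates (n + k) C (f k)) → Tabulates n C (applyUpTo f W)
tabulates-applyUpTo f zero _ = tt
tabulates-applyUpTo {n} {C} f (suc W) R =
  subst (λ m → RowTabulates m C (f 0)) (+-identityʳ n) (R 0 (s≤s z≤n)) ,
  tabulates-applyUpTo (f ∘ suc) W (λ k k<W → subst (λ m → RowTabulates m C (f (suc k))) (+-suc n k) (R (suc k) (s≤s k<W)))

row-⊆-concat : ∀ T k {e} → e ∈ row T k → e ∈ concat T
row-⊆-concat (r ∷ T) zero e∈ = ∈-++⁺ˡ e∈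
row-⊆-concat (r ∷ T) (suc k) e∈ = ∈-++⁺ʳ r (row-⊆-concat T k e∈)

tabulated-entry-occurs : ∀ {n C} T → Tabulates n C T → ∀ {a o} → (a , o) ∈ concat T → ∃[ m ] Occurs m (a , C ⊕ o)
tabulated-entry-occurs (r ∷ T) (R , K) e∈ with ∈-++⁻ r e∈
... | inj₁ e∈r = _ , proj₂ R e∈r
... | inj₂ e∈T = tabulated-entry-occurs T K e∈T

SameRows : Table → Table → Set
SameRows = Pointwise (λ r r′ → All (_∈ r′) r × All (_∈ r) r′)

tabulates-SameRows : ∀ {n C T T′} → SameRows T T′ → Tabulates n C T → Tabulates n C T′
tabulates-SameRows [] _ = tt
tabulates-SameRows ((r⊆r′ , r′⊆r) ∷ same) ((complete , sound) , K) =
  ((λ j → let o , o∈ , ψ≡ = complete j in o , All.lookup r⊆r′ o∈ , ψ≡) , (sound ∘ All.lookup r′⊆r)) ,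
  tabulates-SameRows same K

sameRows? : ∀ T T′ → Dec (SameRows T T′)
sameRows? = Pointwise.decidable (λ r r′ → All.all? (_∈? r′) r ×-dec All.all? (_∈? r) r′)

_⊖_ : Parikh → Parikh → Parikh
(a , b , c) ⊖ (x , y , z) = a ∸ x , b ∸ y , c ∸ z

infix 4 _≤ᴾ_ _≤ᴾ?_

_≤ᴾ_ : Parikh → Parikh → Set
(a , b , c) ≤ᴾ (x , y , z) = a ≤ x × b ≤ y × c ≤ z

_≤ᴾ?_ : ∀ u v → Dec (u ≤ᴾ v)
(a , b , c) ≤ᴾ? (x , y , z) = a ≤? x ×-dec b ≤? y ×-dec c ≤? z

⊕-⊖ : ∀ D w → D ≤ᴾ w → D ⊕ (w ⊖ D) ≡ w
⊕-⊖ (a , b , c) (x , y , z) (p , q , r) = parikh-≡ (m+[n∸m]≡n p) (m+[n∸m]≡n q) (m+[n∸m]≡n r)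

⊕-rebase : ∀ u d x → u ⊕ (d ⊕ e₀ ⊕ x) ≡ u ⊕ d ⊕ x ⊕ e₀
⊕-rebase (a , b , c) (p , q , r) (x , y , z) = parikh-≡ (rearrange a p x) (rearrange′ b q y) (rearrange′ c r z)
  where
  rearrange : ∀ a p x → a + (p + 1 + x) ≡ a + p + x + 1
  rearrange = solve-∀
  rearrange′ : ∀ a p x → a + (p + 0 + x) ≡ a + p + x + 0
  rearrange′ = solve-∀

candidatesOf : Table → List (ℕ × Entry)
candidatesOf T = concatMap candidates (concat T)

∈-candidatesOf⁺ : ∀ T {e p} → e ∈ concat T → p ∈ candidates e → p ∈ candidatesOf T
∈-candidatesOf⁺ T e∈ p∈ = ∈-concatMap⁺ candidates (lose e∈ p∈)

∈-candidatesOf⁻ : ∀ T {p} → p ∈ candidatesOf T → ∃[ e ] e ∈ concat T × p ∈ candidates e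
∈-candidatesOf⁻ T p∈ = find (∈-concatMap⁻ candidates p∈)

rebase : Parikh → ℕ × Entry → Entry
rebase D (_ , b , w) = b , w ⊖ D

descendants : Table → Parikh → ℕ → Row
descendants T D ℓ = deduplicate _≟ᴱ_ (map (rebase D) (filter (λ p → proj₁ p ≟ ℓ) (candidatesOf T)))

∈-descendants⁺ : ∀ T D {ℓ b w} → (ℓ , b , w) ∈ candidatesOf T → (b , w ⊖ D) ∈ descendants T D ℓ
∈-descendants⁺ T D {ℓ} p∈ = ∈-deduplicate⁺ _≟ᴱ_ (∈-map∘filter⁺ (rebase D) (λ p → proj₁ p ≟ ℓ) (_ , p∈ , refl , refl))

∈-descendants⁻ : ∀ T D ℓ {e} → e ∈ descendants T D ℓ → ∃[ b ] ∃[ w ] (ℓ , b , w) ∈ candidatesOf T × e ≡ (b , w ⊖ D)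
∈-descendants⁻ T D ℓ e∈ with ∈-map∘filter⁻ (rebase D) (λ p → proj₁ p ≟ ℓ) {xs = candidatesOf T} (∈-deduplicate⁻ _≟ᴱ_ _ e∈)
... | (_ , b , w) , p∈ , refl , refl = b , w , p∈ , refl

desubstitute : Table → ℕ → ℕ → Parikh → Table
desubstitute T s Wp d = applyUpTo (λ k → descendants T (d ⊕ e₀) (suc (s + k))) Wp

FirstRowBelow : Table → ℕ → Set
FirstRowBelow T s = All (λ e → ∣ Mτ (proj₂ e) ∣ < s) (row T 0)

-- Unless A ≡ 1, factors shorter than A yield only factors shorter than ∣ Mτ C ∣ + s.
ShortAncestorsExcluded : ℕ → Table → ℕ → Set
ShortAncestorsExcluded A T s = A ≡ 1 ⊎ FirstRowBelow T s

-- Factors longer than the table yield only factors that are too long, and every candidate of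
-- a wanted length dominates d ⊕ e₀, so that rebasing subtracts honestly.
record Admissible (T : Table) (s Wp : ℕ) (d : Parikh) : Set where
  constructor admissible
  field
    nonempty : 1 ≤ length T
    2≤s : 2 ≤ s
    long-excluded : All (λ e → s + Wp ≤ suc ∣ Mτ (proj₂ e) ∣) (row T (length T ∸ 1))
    dominated : All (λ p → suc s ≤ proj₁ p → proj₁ p ≤ s + Wp → d ⊕ e₀ ≤ᴾ proj₂ (proj₂ p)) (candidatesOf T)

firstRowBelow? : ∀ T s → Dec (FirstRowBelow T s)
firstRowBelow? T s = All.all? (λ e → ∣ Mτ (proj₂ e) ∣ <? s) (row T 0)

shortAncestorsExcluded? : ∀ A T s → Dec (ShortAncestorsExcluded A T s)
shortAncestorsExcluded? A T s = A ≟ 1 ⊎-dec firstRowBelow? T s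

admissible? : ∀ T s Wp d → Dec (Admissible T s Wp d)
admissible? T s Wp d = map′ (λ { (p , q , r , u) → admissible p q r u }) (λ a → nonempty a , 2≤s a , long-excluded a , dominated a)
  (1 ≤? length T ×-dec 2 ≤? s
   ×-dec All.all? (λ e → s + Wp ≤? suc ∣ Mτ (proj₂ e) ∣) (row T (length T ∸ 1))
   ×-dec All.all? (λ p → suc s ≤? proj₁ p →-dec proj₁ p ≤? s + Wp →-dec d ⊕ e₀ ≤ᴾ? proj₂ (proj₂ p)) (candidatesOf T))
  where open Admissible

module _ {A C T s Wp d} (K : Tabulates A C T) (short : ShortAncestorsExcluded A T s) (adm : Admissible T s Wp d) where
  open Admissible adm

  private
    L = length T
    A′ = ∣ Mτ C ∣ + s
    D = d ⊕ e₀

    suc-A′+k : ∀ k → suc (A′ + k) ≡ ∣ Mτ C ∣ + suc (s + k)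
    suc-A′+k k = trans (cong suc (+-assoc ∣ Mτ C ∣ s k)) (sym (+-suc ∣ Mτ C ∣ (s + k)))

    suc[L∸1]≡L : suc (L ∸ 1) ≡ L
    suc[L∸1]≡L = sym (+-∸-assoc 1 nonempty)

    no-short-ancestor : ∀ {i m k e} → 1 ≤ m → m < A → Yields (t i , ψ i m) (A′ + k) e → ⊥
    no-short-ancestor {i} {m} {k} 1≤m m<A y = excluded short
      where
      excluded : ShortAncestorsExcluded A T s → ⊥
      excluded (inj₁ A≡1) = <-irrefl refl (≤-trans (subst (m <_) A≡1 m<A) 1≤m)
      excluded (inj₂ first-row) with proj₁ (tabulates-row T K 0 nonempty) i
      ... | o , o∈ , ψ≡ = <-irrefl refl (begin-strict
        A′ + k                  ≤⟨ short-ancestor-bound i m A y m<A ⟩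
        ∣ Mτ (ψ i A) ∣          ≡⟨ cong (∣_∣ ∘ Mτ) (trans (cong (ψ i) (sym (+-identityʳ A))) ψ≡) ⟩
        ∣ Mτ (C ⊕ o) ∣          ≡⟨ ∣Mτ-⊕∣ C o ⟩
        ∣ Mτ C ∣ + ∣ Mτ o ∣     <⟨ +-monoʳ-< ∣ Mτ C ∣ (All.lookup first-row o∈) ⟩
        A′                      ≤⟨ m≤m+n A′ k ⟩
        A′ + k                  ∎)
        where open ≤-Reasoning

    no-long-ancestor : ∀ {i m k e} → k < Wp → A + L ≤ m → Yields (t i , ψ i m) (A′ + k) e → ⊥
    no-long-ancestor {i} {m} {k} k<Wp A+L≤m y
      with proj₁ (tabulates-row T K (L ∸ 1) (≤-reflexive suc[L∸1]≡L)) (suc i)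
    ... | o , o∈ , ψ≡ = <-irrefl refl (begin-strict
      A′ + k                        <⟨ +-monoʳ-< A′ k<Wp ⟩
      A′ + Wp                       ≡⟨ +-assoc ∣ Mτ C ∣ s Wp ⟩
      ∣ Mτ C ∣ + (s + Wp)           ≤⟨ +-monoʳ-≤ ∣ Mτ C ∣ (All.lookup long-excluded o∈) ⟩
      ∣ Mτ C ∣ + suc ∣ Mτ o ∣       ≡⟨ ∣Mτ-⊕∣-+ C o 1 ⟨
      suc ∣ Mτ (C ⊕ o) ∣            ≡⟨ cong (λ v → suc ∣ Mτ v ∣) ψ≡ ⟨
      suc ∣ Mτ (ψ (suc i) H) ∣      ≤⟨ long-ancestor-bound i H (m ∸ suc H) (subst (λ l → Yields (t i , ψ i l) (A′ + k) _) m≡ y) ⟩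
      A′ + k                        ∎)
      where
      open ≤-Reasoning
      H = A + (L ∸ 1)
      m≡ : m ≡ suc (H + (m ∸ suc H))
      m≡ = sym (m+[n∸m]≡n (≤-trans (≤-reflexive (trans (sym (+-suc A (L ∸ 1))) (cong (A +_) suc[L∸1]≡L))) A+L≤m))

    descendant-via-row : ∀ {i m k j} → A ≤ m → m < A + L → k < Wp → Yields (t i , ψ i m) (A′ + k) (t j , ψ j (A′ + k)) →
      ∃[ o ] (t j , o) ∈ descendants T D (suc (s + k)) × ψ j (A′ + k) ≡ Mτ C ⊕ d ⊕ o
    descendant-via-row {i} {m} {k} {j} A≤m m<A+L k<Wp y
      with proj₁ (tabulates-row T K (m ∸ A) (+-cancelˡ-< A _ L (subst (_< A + L) (sym (m+[n∸m]≡n A≤m)) m<A+L))) i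
    ... | o , o∈ , ψ≡ with candidates-complete C (t i) o (subst (λ v → Yields (t i , v) (A′ + k) _) ψim≡ y)
      where ψim≡ = trans (cong (ψ i) (sym (m+[n∸m]≡n A≤m))) ψ≡
    ...   | ℓ , w , p∈ , len , vec = w ⊖ D , ∈-descendants⁺ T D (subst (λ ℓ → (ℓ , t j , w) ∈ candidatesOf T) ℓ≡ p∈T) , vector
      where
      p∈T = ∈-candidatesOf⁺ T (row-⊆-concat T (m ∸ A) o∈) p∈
      ℓ≡ : ℓ ≡ suc (s + k)
      ℓ≡ = +-cancelˡ-≡ ∣ Mτ C ∣ ℓ (suc (s + k)) (trans (sym len) (suc-A′+k k))
      D≤w : D ≤ᴾ w
      D≤w = All.lookup dominated p∈T (subst (suc s ≤_) (sym ℓ≡) (s≤s (m≤m+n s k)))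
                                     (subst (_≤ s + Wp) (trans (+-suc s k) (sym ℓ≡)) (+-monoʳ-≤ s k<Wp))
      vector : ψ j (A′ + k) ≡ Mτ C ⊕ d ⊕ (w ⊖ D)
      vector = ⊕-cancelʳ _ _ e₀ (begin
        ψ j (A′ + k) ⊕ e₀                ≡⟨ vec ⟩
        Mτ C ⊕ w                         ≡⟨ cong (Mτ C ⊕_) (⊕-⊖ D w D≤w) ⟨
        Mτ C ⊕ (D ⊕ (w ⊖ D))             ≡⟨ ⊕-rebase (Mτ C) d (w ⊖ D) ⟩
        Mτ C ⊕ d ⊕ (w ⊖ D) ⊕ e₀          ∎)
        where open ≡-Reasoning

    descendants-complete : ∀ k → k < Wp → ∀ j →
      ∃[ o ] (t j , o) ∈ descendants T D (suc (s + k)) × ψ j (A′ + k) ≡ Mτ C ⊕ d ⊕ o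
    descendants-complete k k<Wp j with has-ancestor (A′ + k) j (≤-trans 2≤s (≤-trans (m≤n+m s _) (m≤m+n A′ k)))
    ... | i , m , 1≤m , y with m <? A | m <? A + L
    ...   | yes m<A | _ = ⊥-elim (no-short-ancestor 1≤m m<A y)
    ...   | no _ | no m≮A+L = ⊥-elim (no-long-ancestor k<Wp (≮⇒≥ m≮A+L) y)
    ...   | no m≮A | yes m<A+L = descendant-via-row (≮⇒≥ m≮A) m<A+L k<Wp y

    descendants-sound : ∀ k → k < Wp → ∀ {b o} → (b , o) ∈ descendants T D (suc (s + k)) → Occurs (A′ + k) (b , Mτ C ⊕ d ⊕ o)
    descendants-sound k k<Wp e∈ with ∈-descendants⁻ T D _ e∈
    ... | b , w , p∈ , refl with ∈-candidatesOf⁻ T p∈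
    ...   | (a , o) , e∈T , p∈e with tabulated-entry-occurs T K e∈T
    ...     | m , i , ti≡a , ψ≡ = yields-occurs i m (subst₂ (λ x v → Yields (x , v) (A′ + k) _) (sym ti≡a) (sym ψ≡) y)
      where
      D≤w : D ≤ᴾ w
      D≤w = All.lookup dominated p∈ (s≤s (m≤m+n s k)) (subst (_≤ s + Wp) (+-suc s k) (+-monoʳ-≤ s k<Wp))
      y : Yields (a , C ⊕ o) (A′ + k) (b , Mτ C ⊕ d ⊕ (w ⊖ D))
      y = candidates-sound C a o p∈e (suc-A′+k k)
            (trans (sym (⊕-rebase (Mτ C) d (w ⊖ D))) (cong (Mτ C ⊕_) (⊕-⊖ D w D≤w)))

  desubstitution-step : Tabulates (∣ Mτ C ∣ + s) (Mτ C ⊕ d) (desubstitute T s Wp d)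
  desubstitution-step = tabulates-applyUpTo _ Wp (λ k k<Wp → descendants-complete k k<Wp , descendants-sound k k<Wp)

-- An extension keeps the first row; it needs a step from the lengths A, A + 1, … to A + 1, … over the same base.
data Move : Set where
  shift extend : (s Wp : ℕ) (d : Parikh) → Move

Certifies : List Move → ℕ → Parikh → Table → ℕ → Parikh → Table → Set
Certifies [] A C T A* C* T* = A ≡ A* × C ≡ C* × SameRows T T*
Certifies (shift s Wp d ∷ ms) A C T A* C* T* =
  ShortAncestorsExcluded A T s × Admissible T s Wp d ×
  Certifies ms (∣ Mτ C ∣ + s) (Mτ C ⊕ d) (desubstitute T s Wp d) A* C* T*
Certifies (extend s Wp d ∷ ms) A C T A* C* T* =
  ShortAncestorsExcluded A T s × Admissible T s Wp d × ∣ Mτ C ∣ + s ≡ suc A × Mτ C ⊕ d ≡ C ×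
  Certifies ms A C (row T 0 ∷ desubstitute T s Wp d) A* C* T*

certifies? : ∀ ms A C T A* C* T* → Dec (Certifies ms A C T A* C* T*)
certifies? [] A C T A* C* T* = A ≟ A* ×-dec C ≟ᴾ C* ×-dec sameRows? T T*
certifies? (shift s Wp d ∷ ms) A C T A* C* T* =
  shortAncestorsExcluded? A T s ×-dec admissible? T s Wp d ×-dec
  certifies? ms (∣ Mτ C ∣ + s) (Mτ C ⊕ d) (desubstitute T s Wp d) A* C* T*
certifies? (extend s Wp d ∷ ms) A C T A* C* T* =
  shortAncestorsExcluded? A T s ×-dec admissible? T s Wp d ×-dec ∣ Mτ C ∣ + s ≟ suc A ×-dec Mτ C ⊕ d ≟ᴾ C ×-dec
  certifies? ms A C (row T 0 ∷ desubstitute T s Wp d) A* C* T*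

certified : ∀ ms {A C T A* C* T*} → Tabulates A C T → Certifies ms A C T A* C* T* → Tabulates A* C* T*
certified [] K (refl , refl , same) = tabulates-SameRows same K
certified (shift s Wp d ∷ ms) K (short , adm , c) = certified ms (desubstitution-step K short adm) c
certified (extend s Wp d ∷ ms) {T = []} _ (_ , admissible () _ _ _ , _)
certified (extend s Wp d ∷ ms) {T = r ∷ T} (R , K) (short , adm , len , base , c) =
  certified ms (R , subst₂ (λ n v → Tabulates n v (desubstitute (r ∷ T) s Wp d)) len base (desubstitution-step (R , K) short adm)) c

-- The initial table and the attractor

pattern a₀ = zero
pattern a₁ = suc zero
pattern a₂ = suc (suc zero)

nonzero-followed-by-zero : ∀ j → t j ≢ a₀ → t (suc j) ≡ a₀
nonzero-followed-by-zero j tj≢0 with block j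
... | i , at-σ refl = ⊥-elim (tj≢0 (t-σ i))
... | i , at-σ+1 refl nt = trans (cong t (trans (+-comm 2 (σ i)) (cong (σ i +_) (sym (∣τ∣-NotTwo nt))))) (t-σ (suc i))

initial : Table
initial =
  ((a₀ , 1 , 0 , 0) ∷ (a₁ , 0 , 1 , 0) ∷ (a₂ , 0 , 0 , 1) ∷ [])
  ∷ ((a₀ , 1 , 0 , 1) ∷ (a₀ , 2 , 0 , 0) ∷ (a₀ , 1 , 1 , 0) ∷ (a₁ , 1 , 1 , 0) ∷ (a₂ , 1 , 0 , 1) ∷ [])
  ∷ []

tabulates-initial : Tabulates 1 𝟘 initial
tabulates-initial = (complete₁ , sound₁) , (complete₂ , sound₂) , tt
  where
  complete₁ : ∀ j → ∃[ o ] (t j , o) ∈ row initial 0 × ψ j 1 ≡ 𝟘 ⊕ o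
  complete₁ j = unit (t j) , ∈-row₀ (t j) , ψ-1 j
    where
    ∈-row₀ : ∀ a → (a , unit a) ∈ row initial 0
    ∈-row₀ a₀ = here refl
    ∈-row₀ a₁ = there (here refl)
    ∈-row₀ a₂ = there (there (here refl))
  sound₁ : ∀ {a o} → (a , o) ∈ row initial 0 → Occurs 1 (a , 𝟘 ⊕ o)
  sound₁ (here refl) = 0 , refl , refl
  sound₁ (there (here refl)) = 1 , refl , refl
  sound₁ (there (there (here refl))) = 3 , refl , refl
  complete₂ : ∀ j → ∃[ o ] (t j , o) ∈ row initial 1 × ψ j 2 ≡ 𝟘 ⊕ o
  complete₂ j = pair (t j) (t (suc j)) (nonzero-followed-by-zero j) (trans (ψ-suc j 1) (cong (unit (t j) ⊕_) (ψ-1 (suc j))))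
    where
    pair : ∀ a b {v} → (a ≢ a₀ → b ≡ a₀) → v ≡ unit a ⊕ unit b → ∃[ o ] (a , o) ∈ row initial 1 × v ≡ 𝟘 ⊕ o
    pair a₀ a₀ _ v≡ = _ , there (here refl) , v≡
    pair a₀ a₁ _ v≡ = _ , there (there (here refl)) , v≡
    pair a₀ a₂ _ v≡ = _ , here refl , v≡
    pair a₁ a₀ _ v≡ = _ , there (there (there (here refl))) , v≡
    pair a₂ a₀ _ v≡ = _ , there (there (there (there (here refl)))) , v≡
    pair a₁ (suc b) b≡0 _ with () ← b≡0 (λ ())
    pair a₂ (suc b) b≡0 _ with () ← b≡0 (λ ())
  sound₂ : ∀ {a o} → (a , o) ∈ row initial 1 → Occurs 2 (a , 𝟘 ⊕ o)
  sound₂ (here refl) = 2 , refl , refl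
  sound₂ (there (here refl)) = 6 , refl , refl
  sound₂ (there (there (here refl))) = 0 , refl , refl
  sound₂ (there (there (there (here refl)))) = 1 , refl , refl
  sound₂ (there (there (there (there (here refl))))) = 3 , refl , refl

attractor : Table
attractor =
  ((a₀ , 1 , 0 , 1) ∷ (a₀ , 1 , 1 , 0) ∷ (a₀ , 2 , 0 , 0) ∷ (a₁ , 0 , 1 , 1) ∷ (a₁ , 0 , 2 , 0) ∷ (a₁ , 1 , 1 , 0) ∷ (a₂ , 0 , 1 , 1) ∷ (a₂ , 1 , 0 , 1) ∷ (a₂ , 1 , 1 , 0) ∷ [])
  ∷ ((a₀ , 1 , 1 , 1) ∷ (a₀ , 1 , 2 , 0) ∷ (a₀ , 2 , 0 , 1) ∷ (a₀ , 2 , 1 , 0) ∷ (a₁ , 1 , 1 , 1) ∷ (a₁ , 1 , 2 , 0) ∷ (a₁ , 2 , 1 , 0) ∷ (a₂ , 1 , 1 , 1) ∷ [])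
  ∷ ((a₀ , 2 , 1 , 1) ∷ (a₀ , 2 , 2 , 0) ∷ (a₀ , 3 , 1 , 0) ∷ (a₁ , 1 , 2 , 1) ∷ (a₁ , 2 , 1 , 1) ∷ (a₁ , 2 , 2 , 0) ∷ (a₂ , 1 , 1 , 2) ∷ (a₂ , 1 , 2 , 1) ∷ (a₂ , 2 , 1 , 1) ∷ [])
  ∷ ((a₀ , 2 , 1 , 2) ∷ (a₀ , 2 , 2 , 1) ∷ (a₀ , 3 , 1 , 1) ∷ (a₀ , 3 , 2 , 0) ∷ (a₁ , 2 , 2 , 1) ∷ (a₁ , 2 , 3 , 0) ∷ (a₁ , 3 , 2 , 0) ∷ (a₂ , 2 , 1 , 2) ∷ (a₂ , 2 , 2 , 1) ∷ (a₂ , 3 , 1 , 1) ∷ [])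
  ∷ ((a₀ , 3 , 1 , 2) ∷ (a₀ , 3 , 2 , 1) ∷ (a₀ , 3 , 3 , 0) ∷ (a₀ , 4 , 1 , 1) ∷ (a₀ , 4 , 2 , 0) ∷ (a₁ , 2 , 2 , 2) ∷ (a₁ , 2 , 3 , 1) ∷ (a₁ , 3 , 2 , 1) ∷ (a₁ , 3 , 3 , 0) ∷ (a₂ , 2 , 2 , 2) ∷ (a₂ , 3 , 1 , 2) ∷ (a₂ , 3 , 2 , 1) ∷ [])
  ∷ ((a₀ , 3 , 2 , 2) ∷ (a₀ , 3 , 3 , 1) ∷ (a₀ , 4 , 1 , 2) ∷ (a₀ , 4 , 2 , 1) ∷ (a₀ , 4 , 3 , 0) ∷ (a₁ , 3 , 2 , 2) ∷ (a₁ , 3 , 3 , 1) ∷ (a₁ , 4 , 2 , 1) ∷ (a₁ , 4 , 3 , 0) ∷ (a₂ , 3 , 2 , 2) ∷ (a₂ , 3 , 3 , 1) ∷ (a₂ , 4 , 2 , 1) ∷ [])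
  ∷ ((a₀ , 4 , 2 , 2) ∷ (a₀ , 4 , 3 , 1) ∷ (a₀ , 5 , 2 , 1) ∷ (a₀ , 5 , 3 , 0) ∷ (a₁ , 3 , 3 , 2) ∷ (a₁ , 4 , 2 , 2) ∷ (a₁ , 4 , 3 , 1) ∷ (a₂ , 3 , 3 , 2) ∷ (a₂ , 4 , 2 , 2) ∷ (a₂ , 4 , 3 , 1) ∷ [])
  ∷ ((a₀ , 4 , 3 , 2) ∷ (a₀ , 5 , 2 , 2) ∷ (a₀ , 5 , 3 , 1) ∷ (a₁ , 4 , 3 , 2) ∷ (a₁ , 4 , 4 , 1) ∷ (a₁ , 5 , 3 , 1) ∷ (a₂ , 4 , 3 , 2) ∷ (a₂ , 5 , 2 , 2) ∷ (a₂ , 5 , 3 , 1) ∷ [])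
  ∷ ((a₀ , 5 , 3 , 2) ∷ (a₀ , 5 , 4 , 1) ∷ (a₀ , 6 , 2 , 2) ∷ (a₀ , 6 , 3 , 1) ∷ (a₁ , 4 , 4 , 2) ∷ (a₁ , 5 , 3 , 2) ∷ (a₁ , 5 , 4 , 1) ∷ (a₂ , 5 , 3 , 2) ∷ [])
  ∷ []

moves : List Move
moves =
  map (λ Wp → extend 2 Wp 𝟘) (2 ∷ 4 ∷ 7 ∷ 13 ∷ 24 ∷ 44 ∷ [])
  ++ shift 26 9 (14 , 7 , 3) ∷ shift 6 9 (3 , 0 , 1) ∷ replicate 10 (shift 7 9 (3 , 1 , 1))

certificate : Certifies moves 1 𝟘 initial 24350 (13238 , 7197 , 3913) attractor
certificate = toWitness {a? = certifies? moves 1 𝟘 initial 24350 (13238 , 7197 , 3913) attractor} tt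

attractor-step : ∀ {A C} → Tabulates A C attractor → Tabulates (∣ Mτ C ∣ + 7) (Mτ C ⊕ (3 , 1 , 1)) attractor
attractor-step K =
  tabulates-SameRows (toWitness {a? = sameRows? (desubstitute attractor 7 9 (3 , 1 , 1)) attractor} tt)
    (desubstitution-step K (inj₂ (toWitness {a? = firstRowBelow? attractor 7} tt))
                           (toWitness {a? = admissible? attractor 7 9 (3 , 1 , 1)} tt))

Cₖ : ℕ → Parikh
Cₖ zero = 13238 , 7197 , 3913
Cₖ (suc k) = Mτ (Cₖ k) ⊕ (3 , 1 , 1)

Aₖ : ℕ → ℕ
Aₖ zero = 24350
Aₖ (suc k) = ∣ Mτ (Cₖ k) ∣ + 7

tabulates-attractor : ∀ k → Tabulates (Aₖ k) (Cₖ k) attractor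
tabulates-attractor zero = certified moves {1} {𝟘} {initial} tabulates-initial certificate
tabulates-attractor (suc k) = attractor-step (tabulates-attractor k)

k≤∣Cₖ∣ : ∀ k → k ≤ ∣ Cₖ k ∣
k≤∣Cₖ∣ zero = z≤n
k≤∣Cₖ∣ (suc k) = begin
  suc k                          ≤⟨ s≤s (≤-trans (k≤∣Cₖ∣ k) (∣∣≤∣Mτ∣ (Cₖ k))) ⟩
  suc ∣ Mτ (Cₖ k) ∣              ≤⟨ ≤-trans (≤-reflexive (+-comm 1 _)) (+-monoʳ-≤ ∣ Mτ (Cₖ k) ∣ (s≤s z≤n)) ⟩
  ∣ Mτ (Cₖ k) ∣ + ∣ 3 , 1 , 1 ∣  ≡⟨ ∣⊕∣ (Mτ (Cₖ k)) (3 , 1 , 1) ⟨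
  ∣ Cₖ (suc k) ∣                 ∎
  where open ≤-Reasoning

-- Abelian complexity

ρ≡-row : ∀ {n C r} → RowTabulates n C r → ρ≡ n (length (deduplicate _≟ᴾ_ (map proj₂ r)))
ρ≡-row {n} {C} {r} (complete , sound) =
  map (C ⊕_) os , map⁺ (λ {u} {v} → ⊕-cancelˡ C u v) (deduplicate-! os₀) , length-map (C ⊕_) os , realised , covered
  where
  os₀ = map proj₂ r
  os = deduplicate _≟ᴾ_ os₀
  realised : ∀ v → v ∈ map (C ⊕_) os → IsParikhOfFactor n v
  realised v v∈ with ∈-map⁻ (C ⊕_) v∈
  ... | o , o∈ , refl with ∈-map⁻ proj₂ (∈-deduplicate⁻ _≟ᴾ_ os₀ o∈)
  ...   | (a , o) , e∈ , refl with sound e∈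
  ...     | j , _ , ψ≡ = j , ψ≡
  covered : ∀ i → parikh (factor i n) ∈ map (C ⊕_) os
  covered i with complete i
  ... | o , o∈ , ψ≡ = subst (_∈ map (C ⊕_) os) (sym ψ≡) (∈-map⁺ (C ⊕_) (∈-deduplicate⁺ _≟ᴾ_ (∈-map⁺ proj₂ o∈)))

proposition5 : ∀ m → ∃[ n ] (m < n × ρ≡ n 7)
proposition5 m = Aₖ (suc m) + 4 , m<n , ρ≡-row (tabulates-row attractor (tabulates-attractor (suc m)) 4 (m<m+n 4 (s≤s z≤n)))
  where
  m<n : m < Aₖ (suc m) + 4
  m<n = begin-strict
    m                     ≤⟨ ≤-trans (k≤∣Cₖ∣ m) (∣∣≤∣Mτ∣ (Cₖ m)) ⟩
    ∣ Mτ (Cₖ m) ∣         <⟨ m<m+n _ (s≤s z≤n) ⟩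
    ∣ Mτ (Cₖ m) ∣ + 7     ≤⟨ m≤m+n _ 4 ⟩
    Aₖ (suc m) + 4        ∎
    where open ≤-Reasoning
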